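{- Let $m,n,r,s,t,g\in\mathbb{Q}$ with $s^2\neq t^2$, and put $$x=mg+s,\quad y=ng+t,\quad z=mg-t,\quad w=ng+s,\quad b=1,\quad a=rg+\frac{s^2+t^2}{s^2-t^2}.$$ (i) If $n^2-mrs-mrt\neq 0$ and $$g=\frac{2ms^2-2ns^2+rs^3-rs^2t+2mt^2+2nt^2-rst^2+rt^3}{2(s-t)(n^2-mrs-mrt)},$$ then $a x^2-b y^2=a z^2+b w^2$. (ii) If $m^2-nrs+nrt\neq 0$ and $$g=\frac{ -2ms^2+2ns^2+rs^3+rs^2t+2mt^2+2nt^2-rst^2-rt^3}{2(s+t)(m^2-nrs+nrt)},$$ then $b x^2+a y^2=-b z^2+a w^2$. -}

module Defs where

open import Data.Rational using (ℚ; 0ℚ; 1ℚ; _+_; _-_; _*_; _÷_; -_; ≢-nonZero)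
open import Relation.Binary.PropositionalEquality using (_≢_)

_÷[_] : (p q : ℚ) → q ≢ 0ℚ → ℚ
(p ÷[ q ]) q≢0 = _÷_ p q {{≢-nonZero q≢0}}

2ℚ : ℚ
2ℚ = 1ℚ + 1ℚ

sq : ℚ → ℚ
sq u = u * u

cube : ℚ → ℚ
cube u = u * u * u

-- Write a = r g + q with q = (s² + t²)/(s² − t²).  In (i), multiplying the difference of the two
-- sides by s − t and using q (s² − t²) = s² + t² kills the constant term and leaves g (N₁ − D₁ g),
-- where N₁/D₁ is the prescribed value of g; as s − t ≠ 0 the difference vanishes.  Part (ii) is the
-- same computation with the factor s + t.
module Submission where

open import Defs
open import Data.Rational using (ℚ; 0ℚ; 1ℚ; _+_; _-_; _*_; -_; 1/_; ≢-nonZero)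
open import Data.Rational.Properties
  using (_≟_; +-*-commutativeRing; +-0-group; *-assoc; *-inverseˡ;
         *-identityˡ; *-identityʳ; *-zeroˡ; *-zeroʳ; +-identityʳ)
open import Algebra.Properties.Group +-0-group using (x∙y⁻¹≈ε⇒x≈y; x≈y⇒x∙y⁻¹≈ε)
open import Data.Maybe using (just; nothing)
open import Data.Product using (_×_; _,_)
open import Function using (case_of_)
open import Level using (0ℓ)
open import Relation.Nullary using (yes; no)
open import Relation.Binary.PropositionalEquality
  using (_≡_; _≢_; refl; sym; trans; cong; cong₂; module ≡-Reasoning)
open import Tactic.RingSolver using (solve-∀)
open import Tactic.RingSolver.Core.AlmostCommutativeRing using (AlmostCommutativeRing; fromCommutativeRing)

ℚ-ring : AlmostCommutativeRing 0ℓ 0ℓ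
ℚ-ring = fromCommutativeRing +-*-commutativeRing
  λ p → case 0ℚ ≟ p of λ { (yes 0≡p) → just 0≡p ; (no _) → nothing }

÷[]-*-cancel : ∀ p q (q≢0 : q ≢ 0ℚ) → (p ÷[ q ]) q≢0 * q ≡ p
÷[]-*-cancel p q q≢0 = begin
  p * 1/ q * q    ≡⟨ *-assoc p (1/ q) q ⟩
  p * (1/ q * q)  ≡⟨ cong (p *_) (*-inverseˡ q) ⟩
  p * 1ℚ          ≡⟨ *-identityʳ p ⟩
  p               ∎
  where
  open ≡-Reasoning
  instance _ = ≢-nonZero q≢0

*-cancelˡ-≡0 : ∀ {p q} → p ≢ 0ℚ → p * q ≡ 0ℚ → q ≡ 0ℚ
*-cancelˡ-≡0 {p} {q} p≢0 pq≡0 = begin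
  q                ≡⟨ *-identityˡ q ⟨
  1ℚ * q           ≡⟨ cong (_* q) (*-inverseˡ p) ⟨
  1/ p * p * q     ≡⟨ *-assoc (1/ p) p q ⟩
  1/ p * (p * q)   ≡⟨ cong (1/ p *_) pq≡0 ⟩
  1/ p * 0ℚ        ≡⟨ *-zeroʳ (1/ p) ⟩
  0ℚ               ∎
  where
  open ≡-Reasoning
  instance _ = ≢-nonZero p≢0

2*p*q≢0⇒p≢0 : ∀ p q → 2ℚ * p * q ≢ 0ℚ → p ≢ 0ℚ
2*p*q≢0⇒p≢0 p q 2pq≢0 refl = 2pq≢0 (trans (cong (_* q) (*-zeroʳ 2ℚ)) (*-zeroˡ q))

≡÷[]⇒*≡ : ∀ {g} p q (q≢0 : q ≢ 0ℚ) → g ≡ (p ÷[ q ]) q≢0 → g * q ≡ p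
≡÷[]⇒*≡ p q q≢0 refl = ÷[]-*-cancel p q q≢0

≡-by-combination : ∀ {c L R u v} g k → c ≢ 0ℚ → c * (L - R) ≡ g * u + v * k →
                   u ≡ 0ℚ → v ≡ 0ℚ → L ≡ R
≡-by-combination {c} {L} {R} {u} {v} g k c≢0 identity u≡0 v≡0 =
  x∙y⁻¹≈ε⇒x≈y L R (*-cancelˡ-≡0 c≢0 c[L-R]≡0)
  where
  open ≡-Reasoning
  c[L-R]≡0 : c * (L - R) ≡ 0ℚ
  c[L-R]≡0 = begin
    c * (L - R)        ≡⟨ identity ⟩
    g * u + v * k      ≡⟨ cong₂ (λ u′ v′ → g * u′ + v′ * k) u≡0 v≡0 ⟩
    g * 0ℚ + 0ℚ * k    ≡⟨ cong₂ _+_ (*-zeroʳ g) (*-zeroˡ k) ⟩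
    0ℚ + 0ℚ            ≡⟨ +-identityʳ 0ℚ ⟩
    0ℚ                 ∎

-- Both identities are stated with sq and cube unfolded, as the solver does not look through them.
identity₁ : ∀ m n r s t g q →
  (s - t) * (((r * g + q) * ((m * g + s) * (m * g + s)) - 1ℚ * ((n * g + t) * (n * g + t)))
             - ((r * g + q) * ((m * g - t) * (m * g - t)) + 1ℚ * ((n * g + s) * (n * g + s))))
  ≡ g * ((2ℚ * m * (s * s) - 2ℚ * n * (s * s) + r * (s * s * s) - r * (s * s) * t
          + 2ℚ * m * (t * t) + 2ℚ * n * (t * t) - r * s * (t * t) + r * (t * t * t))
         - g * (2ℚ * (s - t) * (n * n - m * r * s - m * r * t)))
    + (q * (s * s - t * t) - (s * s + t * t)) * (2ℚ * m * g + s - t)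
identity₁ = solve-∀ ℚ-ring

identity₂ : ∀ m n r s t g q →
  (s + t) * ((- (1ℚ * ((m * g - t) * (m * g - t))) + (r * g + q) * ((n * g + s) * (n * g + s)))
             - (1ℚ * ((m * g + s) * (m * g + s)) + (r * g + q) * ((n * g + t) * (n * g + t))))
  ≡ g * ((- (2ℚ * m * (s * s)) + 2ℚ * n * (s * s) + r * (s * s * s) + r * (s * s) * t
          + 2ℚ * m * (t * t) + 2ℚ * n * (t * t) - r * s * (t * t) - r * (t * t * t))
         - g * (2ℚ * (s + t) * (m * m - n * r * s + n * r * t)))
    + (q * (s * s - t * t) - (s * s + t * t)) * (2ℚ * n * g + s + t)
identity₂ = solve-∀ ℚ-ring

theorem2p3 : (m n r s t g : ℚ) → (hst : sq s - sq t ≢ 0ℚ) →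
    let x = m * g + s
        y = n * g + t
        z = m * g - t
        w = n * g + s
        b = 1ℚ
        a = r * g + ((sq s + sq t) ÷[ sq s - sq t ]) hst
    in ((D₁ : 2ℚ * (s - t) * (sq n - m * r * s - m * r * t) ≢ 0ℚ) →
         sq n - m * r * s - m * r * t ≢ 0ℚ →
         g ≡ ((2ℚ * m * sq s - 2ℚ * n * sq s + r * cube s - r * sq s * t
               + 2ℚ * m * sq t + 2ℚ * n * sq t - r * s * sq t + r * cube t)
              ÷[ 2ℚ * (s - t) * (sq n - m * r * s - m * r * t) ]) D₁ →
         a * sq x - b * sq y ≡ a * sq z + b * sq w)
     × ((D₂ : 2ℚ * (s + t) * (sq m - n * r * s + n * r * t) ≢ 0ℚ) →
         sq m - n * r * s + n * r * t ≢ 0ℚ →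
         g ≡ ((- (2ℚ * m * sq s) + 2ℚ * n * sq s + r * cube s + r * sq s * t
               + 2ℚ * m * sq t + 2ℚ * n * sq t - r * s * sq t - r * cube t)
              ÷[ 2ℚ * (s + t) * (sq m - n * r * s + n * r * t) ]) D₂ →
         b * sq x + a * sq y ≡ - (b * sq z) + a * sq w)
-- The nonvanishing hypotheses on the second factors of D₁ and D₂ are implied by D₁ and D₂.
theorem2p3 m n r s t g hst =
  (λ D₁≢0 _ g≡N₁/D₁ →
    ≡-by-combination g (2ℚ * m * g + s - t) (2*p*q≢0⇒p≢0 (s - t) _ D₁≢0) (identity₁ m n r s t g q)
      (x≈y⇒x∙y⁻¹≈ε (sym (≡÷[]⇒*≡ N₁ D₁ D₁≢0 g≡N₁/D₁))) q-defining) ,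
  (λ D₂≢0 _ g≡N₂/D₂ →
    sym (≡-by-combination g (2ℚ * n * g + s + t) (2*p*q≢0⇒p≢0 (s + t) _ D₂≢0) (identity₂ m n r s t g q)
      (x≈y⇒x∙y⁻¹≈ε (sym (≡÷[]⇒*≡ N₂ D₂ D₂≢0 g≡N₂/D₂))) q-defining))
  where
  q : ℚ
  q = ((sq s + sq t) ÷[ sq s - sq t ]) hst
  q-defining : q * (sq s - sq t) - (sq s + sq t) ≡ 0ℚ
  q-defining = x≈y⇒x∙y⁻¹≈ε (÷[]-*-cancel (sq s + sq t) (sq s - sq t) hst)
  N₁ D₁ N₂ D₂ : ℚ
  N₁ = 2ℚ * m * sq s - 2ℚ * n * sq s + r * cube s - r * sq s * t
       + 2ℚ * m * sq t + 2ℚ * n * sq t - r * s * sq t + r * cube t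
  D₁ = 2ℚ * (s - t) * (sq n - m * r * s - m * r * t)
  N₂ = - (2ℚ * m * sq s) + 2ℚ * n * sq s + r * cube s + r * sq s * t
       + 2ℚ * m * sq t + 2ℚ * n * sq t - r * s * sq t - r * cube t
  D₂ = 2ℚ * (s + t) * (sq m - n * r * s + n * r * t)
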